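{- Let $a,c$ be rational numbers with $0<a<1$ and $0<c<1$, such that $2a$ and $2c$ are not both integers. Let $M_1$ be the least common multiple of the denominators of $a$ and $c$. Define $B(a;c)\subseteq(\mathbf{Z}/M_1\mathbf{Z})^\times$ as follows: - if $2a\notin\mathbf{Z}$, then $B(a;c)=\{u:\{ -u^jc\}\le\tfrac12\{ -2u^ja\}\text{ for all }j\ge0\}$; - if $2a\in\mathbf{Z}$ (that is, $a=\tfrac12$), then $B(a;c)=\{u:\{ -u^jc\}\le\{ -u^j\tfrac12\}\text{ for all }j\ge0\}$. Set $D(a;c)=|B(a;c)|/\phi(M_1)$. Then $D(a;c)\le\tfrac12$.
   Context: $\{x\}=x-\lfloor x\rfloor$ is the fractional part, and $\phi$ is Euler's totient function. The defining conditions depend only on the class of $u$ modulo $M_1$. -}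

module Defs where

open import Data.Nat as ℕ using (ℕ; _^_; _<_)
open import Data.Nat.LCM using (lcm)
open import Data.Nat.Coprimality using (Coprime; coprime?)
open import Data.List using (List; length; filter; upTo)
open import Data.Integer using (ℤ; +_)
open import Data.Rational
  using (ℚ; ↥_; ↧ₙ_; _/_; floor; _-_; -_; _*_; _≤_; ½)
open import Data.Product using (_×_)
open import Relation.Nullary using (¬_)
open import Relation.Binary.PropositionalEquality using (_≡_)

frac : ℚ → ℚ
frac x = x - (floor x / 1)

IsInt : ℚ → Set
IsInt x = ↧ₙ x ≡ 1

ℕtoℚ : ℕ → ℚ
ℕtoℚ n = (+ n) / 1

two : ℚ
two = ℕtoℚ 2

-- Euler's totient: φ(n) = #{ k : 0 ≤ k < n , gcd(k,n) = 1 }  (φ(1) = 1)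
φ : ℕ → ℕ
φ n = length (filter (λ k → coprime? k n) (upTo n))

M₁ : ℚ → ℚ → ℕ
M₁ a c = lcm (↧ₙ a) (↧ₙ c)

BCond : ℚ → ℚ → ℕ → ℕ → Set
BCond a c u j =
  (¬ IsInt (two * a) →
     frac (- (ℕtoℚ (u ^ j) * c)) ≤ ½ * frac (- (two * (ℕtoℚ (u ^ j) * a))))
  × (IsInt (two * a) →
     frac (- (ℕtoℚ (u ^ j) * c)) ≤ frac (- (ℕtoℚ (u ^ j) * ½)))

-- u (a representative 0 ≤ u < M₁ of a residue class) lies in B(a;c) ⊆ (ℤ/M₁ℤ)ˣ
InB : ℚ → ℚ → ℕ → Set
InB a c u = (u < M₁ a c) × Coprime u (M₁ a c) × (∀ (j : ℕ) → BCond a c u j)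

-- Suppose u and v ≡ −u (mod M₁) both lie in B(a;c)
-- and put x = uc. Since M₁c ∈ ℤ we have {−vc} = {x}, and likewise for the multiples of a,
-- so the two conditions bound {x} and {−x}, whose sum is 1 because x ∉ ℤ (u is a unit
-- mod M₁ and 0 < c < 1). If 2a ∉ ℤ the bounds add up to at most ½({2ua} + {−2ua}) ≤ ½,
-- which is absurd. If a = ½ they force {uc} = {u/2}, so u(c − ½) ∈ ℤ; as M₁(c − ½) ∈ ℤ
-- too and u is coprime to M₁, c − ½ ∈ ℤ, i.e. 2c ∈ ℤ, which is excluded. Hence B(a;c)
-- and −B(a;c) are disjoint sets of units mod M₁, and 2 |B(a;c)| ≤ φ(M₁).

module Submission where

open import Defs
open import Data.Nat as ℕ using (ℕ; suc)
import Data.Nat.Properties as ℕ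
open import Data.Product using (∃-syntax; _×_; _,_; proj₁; proj₂; map₂; uncurry)
open import Data.Empty using (⊥; ⊥-elim)
open import Relation.Nullary using (¬_; yes; no; contradiction)
open import Relation.Binary.Definitions using (tri<; tri≈; tri>)
open import Relation.Binary.PropositionalEquality

-- ℚ's operators are opened only inside this module: proposition5p1 uses ℕ's _*_ and _≤_.
module FractionalPart where

  open import Level using (0ℓ)
  open import Data.Nat.Coprimality as Coprimality using (Coprime)
  open import Data.Nat.Divisibility using (_∣_; divides)
  open import Data.Nat.LCM using (m∣lcm[m,n]; n∣lcm[m,n])
  open import Data.Nat.GCD using (module Bézout)
  open import Data.Integer.Base as ℤ using (ℤ; +_; -[1+_])
  import Data.Integer.Properties as ℤ
  import Data.Integer.DivMod as ℤ
  import Data.Integer.Tactic.RingSolver as ℤ-Solver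
  open import Data.Rational.Base
  open import Data.Rational.Literals using (fromℤ)
  open import Data.Rational.Properties as ℚ using (_≟_)
  import Data.Rational.Unnormalised.Base as ℚᵘ
  import Data.Rational.Unnormalised.Properties as ℚᵘ
  open import Relation.Nullary.Decidable using (Dec; map′; dec⇒maybe)
  open import Tactic.RingSolver using (solve-∀)
  open import Tactic.RingSolver.Core.AlmostCommutativeRing
    using (AlmostCommutativeRing; fromCommutativeRing)

  ℚ-ring : AlmostCommutativeRing 0ℓ 0ℓ
  ℚ-ring = fromCommutativeRing ℚ.+-*-commutativeRing (λ x → dec⇒maybe (0ℚ ≟ x))

  -- Integers inside ℚ

  ℤtoℚ : ℤ → ℚ
  ℤtoℚ k = k / 1

  ℤtoℚ≡fromℤ : ∀ k → ℤtoℚ k ≡ fromℤ k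
  ℤtoℚ≡fromℤ (+ n)    = ℚ.normalize-coprime (Coprimality.sym (Coprimality.1-coprimeTo n))
  ℤtoℚ≡fromℤ -[1+ n ] = cong -_ (ℚ.normalize-coprime (Coprimality.sym (Coprimality.1-coprimeTo (suc n))))

  toℚᵘ-ℤtoℚ : ∀ k → toℚᵘ (ℤtoℚ k) ≡ ℚᵘ.mkℚᵘ k 0
  toℚᵘ-ℤtoℚ k rewrite ℤtoℚ≡fromℤ k = refl

  ℤtoℚ-+ : ∀ m n → ℤtoℚ (m ℤ.+ n) ≡ ℤtoℚ m + ℤtoℚ n
  ℤtoℚ-+ m n = ℚ.toℚᵘ-injective (begin-equality
    toℚᵘ (ℤtoℚ (m ℤ.+ n))             ≡⟨ toℚᵘ-ℤtoℚ (m ℤ.+ n) ⟩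
    ℚᵘ.mkℚᵘ (m ℤ.+ n) 0                ≃⟨ ℚᵘ.*≡* (identity m n) ⟩
    ℚᵘ.mkℚᵘ m 0 ℚᵘ.+ ℚᵘ.mkℚᵘ n 0       ≡⟨ sym (cong₂ ℚᵘ._+_ (toℚᵘ-ℤtoℚ m) (toℚᵘ-ℤtoℚ n)) ⟩
    toℚᵘ (ℤtoℚ m) ℚᵘ.+ toℚᵘ (ℤtoℚ n)  ≃⟨ ℚᵘ.≃-sym (ℚ.toℚᵘ-homo-+ (ℤtoℚ m) (ℤtoℚ n)) ⟩
    toℚᵘ (ℤtoℚ m + ℤtoℚ n)            ∎)
    where
    open ℚᵘ.≤-Reasoning
    identity : ∀ m n → (m ℤ.+ n) ℤ.* (+ 1 ℤ.* + 1) ≡ (m ℤ.* + 1 ℤ.+ n ℤ.* + 1) ℤ.* + 1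
    identity = ℤ-Solver.solve-∀

  ℤtoℚ-* : ∀ m n → ℤtoℚ (m ℤ.* n) ≡ ℤtoℚ m * ℤtoℚ n
  ℤtoℚ-* m n = ℚ.toℚᵘ-injective (begin-equality
    toℚᵘ (ℤtoℚ (m ℤ.* n))             ≡⟨ toℚᵘ-ℤtoℚ (m ℤ.* n) ⟩
    ℚᵘ.mkℚᵘ (m ℤ.* n) 0                ≃⟨ ℚᵘ.*≡* (identity m n) ⟩
    ℚᵘ.mkℚᵘ m 0 ℚᵘ.* ℚᵘ.mkℚᵘ n 0       ≡⟨ sym (cong₂ ℚᵘ._*_ (toℚᵘ-ℤtoℚ m) (toℚᵘ-ℤtoℚ n)) ⟩
    toℚᵘ (ℤtoℚ m) ℚᵘ.* toℚᵘ (ℤtoℚ n)  ≃⟨ ℚᵘ.≃-sym (ℚ.toℚᵘ-homo-* (ℤtoℚ m) (ℤtoℚ n)) ⟩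
    toℚᵘ (ℤtoℚ m * ℤtoℚ n)            ∎)
    where
    open ℚᵘ.≤-Reasoning
    identity : ∀ m n → (m ℤ.* n) ℤ.* (+ 1 ℤ.* + 1) ≡ (m ℤ.* n) ℤ.* + 1
    identity = ℤ-Solver.solve-∀

  ℤtoℚ-neg : ∀ k → ℤtoℚ (ℤ.- k) ≡ - ℤtoℚ k
  ℤtoℚ-neg k = ℚ.toℚᵘ-injective (begin-equality
    toℚᵘ (ℤtoℚ (ℤ.- k))    ≡⟨ toℚᵘ-ℤtoℚ (ℤ.- k) ⟩
    ℚᵘ.- ℚᵘ.mkℚᵘ k 0        ≡⟨ sym (cong ℚᵘ.-_ (toℚᵘ-ℤtoℚ k)) ⟩
    ℚᵘ.- toℚᵘ (ℤtoℚ k)     ≃⟨ ℚᵘ.≃-sym (ℚ.toℚᵘ-homo‿- (ℤtoℚ k)) ⟩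
    toℚᵘ (- ℤtoℚ k)        ∎)
    where open ℚᵘ.≤-Reasoning

  ℤtoℚ-cancel-< : ∀ {m n} → ℤtoℚ m < ℤtoℚ n → m ℤ.< n
  ℤtoℚ-cancel-< {m} {n} m<n rewrite ℤtoℚ≡fromℤ m | ℤtoℚ≡fromℤ n =
    subst₂ ℤ._<_ (ℤ.*-identityʳ m) (ℤ.*-identityʳ n) (ℚ.drop-*<* m<n)

  <suc⇒≤ : ∀ {i j} → i ℤ.< ℤ.suc j → i ℤ.≤ j
  <suc⇒≤ {i} {j} i<1+j = subst (i ℤ.≤_) (ℤ.pred-suc j) (ℤ.i<j⇒i≤pred[j] i<1+j)

  Integral : ℚ → Set
  Integral x = ∃[ k ] x ≡ ℤtoℚ k

  IsInt⇒Integral : ∀ {x} → IsInt x → Integral x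
  IsInt⇒Integral {mkℚ k 0 _} refl = k , sym (ℤtoℚ≡fromℤ k)

  Integral⇒IsInt : ∀ {x} → Integral x → IsInt x
  Integral⇒IsInt (k , refl) rewrite ℤtoℚ≡fromℤ k = refl

  integral? : ∀ x → Dec (Integral x)
  integral? x = map′ IsInt⇒Integral Integral⇒IsInt (↧ₙ x ℕ.≟ 1)

  Integral-+ : ∀ {x y} → Integral x → Integral y → Integral (x + y)
  Integral-+ (k , refl) (l , refl) = k ℤ.+ l , sym (ℤtoℚ-+ k l)

  Integral-neg : ∀ {x} → Integral x → Integral (- x)
  Integral-neg (k , refl) = ℤ.- k , sym (ℤtoℚ-neg k)

  Integral-* : ∀ {x y} → Integral x → Integral y → Integral (x * y)
  Integral-* (k , refl) (l , refl) = k ℤ.* l , sym (ℤtoℚ-* k l)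

  ¬Integral-between-0-1 : ∀ {x} → 0ℚ < x → x < 1ℚ → ¬ Integral x
  ¬Integral-between-0-1 0<k k<1 (k , refl) =
    ℤ.<-irrefl refl
      (ℤ.≤-<-trans (ℤ.i<j⇒suc[i]≤j (ℤtoℚ-cancel-< {+ 0} {k} 0<k)) (ℤtoℚ-cancel-< {k} {+ 1} k<1))

  Integral[2a]⇒a≡½ : ∀ {a} → 0ℚ < a → a < 1ℚ → Integral (two * a) → a ≡ ½
  Integral[2a]⇒a≡½ {a} 0<a a<1 (k , 2a≡k) = begin
    a              ≡⟨ identity a ⟩
    ½ * (two * a)  ≡⟨ cong (λ t → ½ * t) (trans 2a≡k (cong ℤtoℚ k≡1)) ⟩
    ½ * 1ℚ         ≡⟨ ℚ.*-identityʳ ½ ⟩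
    ½              ∎
    where
    open ≡-Reasoning
    identity : ∀ a → a ≡ ½ * (two * a)
    identity = solve-∀ ℚ-ring
    0<k : + 0 ℤ.< k
    0<k = ℤtoℚ-cancel-< {+ 0} {k} (subst (0ℚ <_) 2a≡k (ℚ.*-monoʳ-<-pos two 0<a))
    k<2 : k ℤ.< + 2
    k<2 = ℤtoℚ-cancel-< {k} {+ 2} (subst (_< two) 2a≡k (ℚ.*-monoʳ-<-pos two a<1))
    k≡1 : k ≡ + 1
    k≡1 = ℤ.≤-antisym (<suc⇒≤ k<2) (ℤ.i<j⇒suc[i]≤j 0<k)

  ℕtoℚ-+ : ∀ m n → ℕtoℚ (m ℕ.+ n) ≡ ℕtoℚ m + ℕtoℚ n
  ℕtoℚ-+ m n = trans (cong ℤtoℚ (ℤ.pos-+ m n)) (ℤtoℚ-+ (+ m) (+ n))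

  ℕtoℚ-* : ∀ m n → ℕtoℚ (m ℕ.* n) ≡ ℕtoℚ m * ℕtoℚ n
  ℕtoℚ-* m n = trans (cong ℤtoℚ (ℤ.pos-* m n)) (ℤtoℚ-* (+ m) (+ n))

  Integral[↧q*q] : ∀ q → Integral (ℕtoℚ (↧ₙ q) * q)
  Integral[↧q*q] q@(mkℚ n d-1 _) = n , ℚ.toℚᵘ-injective (begin-equality
    toℚᵘ (ℤtoℚ (+ suc d-1) * q)              ≃⟨ ℚ.toℚᵘ-homo-* (ℤtoℚ (+ suc d-1)) q ⟩
    toℚᵘ (ℤtoℚ (+ suc d-1)) ℚᵘ.* toℚᵘ q     ≡⟨ cong (ℚᵘ._* toℚᵘ q) (toℚᵘ-ℤtoℚ (+ suc d-1)) ⟩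
    ℚᵘ.mkℚᵘ (+ suc d-1) 0 ℚᵘ.* toℚᵘ q        ≃⟨ ℚᵘ.*≡* cross-multiplied ⟩
    ℚᵘ.mkℚᵘ n 0                               ≡⟨ toℚᵘ-ℤtoℚ n ⟨
    toℚᵘ (ℤtoℚ n)                             ∎)
    where
    open ℚᵘ.≤-Reasoning
    identity : ∀ d n → (d ℤ.* n) ℤ.* + 1 ≡ n ℤ.* d
    identity = ℤ-Solver.solve-∀
    cross-multiplied : (+ suc d-1 ℤ.* n) ℤ.* + 1 ≡ n ℤ.* + suc (d-1 ℕ.+ 0)
    cross-multiplied =
      trans (identity (+ suc d-1) n) (cong (λ t → n ℤ.* + suc t) (sym (ℕ.+-identityʳ d-1)))

  Integral-multiple : ∀ {d n y} → d ∣ n → Integral (ℕtoℚ d * y) → Integral (ℕtoℚ n * y)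
  Integral-multiple {d} {y = y} (divides t refl) dy∈ℤ =
    subst Integral td*y≡ (Integral-* (+ t , refl) dy∈ℤ)
    where
    td*y≡ : ℕtoℚ t * (ℕtoℚ d * y) ≡ ℕtoℚ (t ℕ.* d) * y
    td*y≡ = trans (sym (ℚ.*-assoc (ℕtoℚ t) (ℕtoℚ d) y)) (cong (_* y) (sym (ℕtoℚ-* t d)))

  Integral-Bézout : ∀ {m n y} r s → 1 ℕ.+ s ℕ.* n ≡ r ℕ.* m →
    Integral (ℕtoℚ m * y) → Integral (ℕtoℚ n * y) → Integral y
  Integral-Bézout {m} {n} {y} r s bézout my∈ℤ ny∈ℤ =
    subst Integral (sym y≡)
      (Integral-+ (Integral-* (+ r , refl) my∈ℤ) (Integral-neg (Integral-* (+ s , refl) ny∈ℤ)))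
    where
    open ≡-Reasoning
    R = ℕtoℚ r
    S = ℕtoℚ s
    bézoutℚ : 1ℚ + S * ℕtoℚ n ≡ R * ℕtoℚ m
    bézoutℚ = begin
      1ℚ + S * ℕtoℚ n          ≡⟨ cong (λ t → 1ℚ + t) (ℕtoℚ-* s n) ⟨
      1ℚ + ℕtoℚ (s ℕ.* n)      ≡⟨ ℕtoℚ-+ 1 (s ℕ.* n) ⟨
      ℕtoℚ (1 ℕ.+ s ℕ.* n)     ≡⟨ cong ℕtoℚ bézout ⟩
      ℕtoℚ (r ℕ.* m)           ≡⟨ ℕtoℚ-* r m ⟩
      R * ℕtoℚ m               ∎
    identity₁ : ∀ y s n → y ≡ (1ℚ + s * n) * y - s * (n * y)
    identity₁ = solve-∀ ℚ-ring
    identity₂ : ∀ y r m s n → (r * m) * y - s * (n * y) ≡ r * (m * y) - s * (n * y)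
    identity₂ = solve-∀ ℚ-ring
    y≡ : y ≡ R * (ℕtoℚ m * y) - S * (ℕtoℚ n * y)
    y≡ = begin
      y                                         ≡⟨ identity₁ y S (ℕtoℚ n) ⟩
      (1ℚ + S * ℕtoℚ n) * y - S * (ℕtoℚ n * y)  ≡⟨ cong (λ t → t * y - S * (ℕtoℚ n * y)) bézoutℚ ⟩
      (R * ℕtoℚ m) * y - S * (ℕtoℚ n * y)       ≡⟨ identity₂ y R (ℕtoℚ m) S (ℕtoℚ n) ⟩
      R * (ℕtoℚ m * y) - S * (ℕtoℚ n * y)       ∎

  Integral-coprime : ∀ {m n y} → Coprime m n →
    Integral (ℕtoℚ m * y) → Integral (ℕtoℚ n * y) → Integral y
  Integral-coprime m⊥n my∈ℤ ny∈ℤ with Coprimality.coprime-Bézout m⊥n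
  ... | Bézout.+- r s bézout = Integral-Bézout r s bézout my∈ℤ ny∈ℤ
  ... | Bézout.-+ r s bézout = Integral-Bézout s r bézout ny∈ℤ my∈ℤ

  -- Fractional parts

  floor-≤ : ∀ x → ℤtoℚ (floor x) ≤ x
  floor-≤ x@(mkℚ n d-1 _) rewrite ℤtoℚ≡fromℤ (floor x) =
    *≤* (subst (floor x ℤ.* + suc d-1 ℤ.≤_) (sym (ℤ.*-identityʳ n)) (ℤ.[n/d]*d≤n n (+ suc d-1)))

  <suc[floor] : ∀ x → x < ℤtoℚ (ℤ.suc (floor x))
  <suc[floor] x@(mkℚ n d-1 _) rewrite ℤtoℚ≡fromℤ (ℤ.suc (floor x)) = *<* (begin-strict
    n ℤ.* + 1                  ≡⟨ ℤ.*-identityʳ n ⟩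
    n                          ≡⟨ ℤ.a≡a%n+[a/n]*n n d ⟩
    + (n ℤ.% d) ℤ.+ f ℤ.* d   <⟨ ℤ.+-monoˡ-< (f ℤ.* d) (ℤ.+<+ (ℤ.n%d<d n d)) ⟩
    d ℤ.+ f ℤ.* d              ≡⟨ identity d f ⟩
    ℤ.suc f ℤ.* d              ∎)
    where
    open ℤ.≤-Reasoning
    d = + suc d-1
    f = floor x
    identity : ∀ d f → d ℤ.+ f ℤ.* d ≡ (+ 1 ℤ.+ f) ℤ.* d
    identity = ℤ-Solver.solve-∀

  floor-unique : ∀ {x} k → ℤtoℚ k ≤ x → x < ℤtoℚ (ℤ.suc k) → floor x ≡ k
  floor-unique {x} k k≤x x<1+k = ℤ.≤-antisym
    (<suc⇒≤ (ℤtoℚ-cancel-< {floor x} {ℤ.suc k} (ℚ.≤-<-trans (floor-≤ x) x<1+k)))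
    (<suc⇒≤ (ℤtoℚ-cancel-< {k} {ℤ.suc (floor x)} (ℚ.≤-<-trans k≤x (<suc[floor] x))))

  x≡frac+floor : ∀ x → x ≡ frac x + ℤtoℚ (floor x)
  x≡frac+floor x = identity x (ℤtoℚ (floor x))
    where
    identity : ∀ x f → x ≡ (x - f) + f
    identity = solve-∀ ℚ-ring

  frac-nonNeg : ∀ x → 0ℚ ≤ frac x
  frac-nonNeg x = begin
    0ℚ      ≡⟨ sym (ℚ.+-inverseʳ f) ⟩
    f - f   ≤⟨ ℚ.+-monoˡ-≤ (- f) (floor-≤ x) ⟩
    x - f   ∎
    where
    open ℚ.≤-Reasoning
    f = ℤtoℚ (floor x)

  frac<1 : ∀ x → frac x < 1ℚ
  frac<1 x = begin-strict
    x - f                        <⟨ ℚ.+-monoˡ-< (- f) (<suc[floor] x) ⟩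
    ℤtoℚ (ℤ.suc (floor x)) - f  ≡⟨ cong (_- f) (ℤtoℚ-+ (+ 1) (floor x)) ⟩
    1ℚ + f - f                   ≡⟨ identity f ⟩
    1ℚ                           ∎
    where
    open ℚ.≤-Reasoning
    f = ℤtoℚ (floor x)
    identity : ∀ f → 1ℚ + f - f ≡ 1ℚ
    identity = solve-∀ ℚ-ring

  frac-unique : ∀ {x y} k → 0ℚ ≤ y → y < 1ℚ → x ≡ y + ℤtoℚ k → frac x ≡ y
  frac-unique {y = y} k 0≤y y<1 refl = begin
    y + ℤtoℚ k - ℤtoℚ (floor (y + ℤtoℚ k))  ≡⟨ cong (λ i → y + ℤtoℚ k - ℤtoℚ i) floor≡k ⟩
    y + ℤtoℚ k - ℤtoℚ k                      ≡⟨ identity y (ℤtoℚ k) ⟩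
    y                                         ∎
    where
    open ≡-Reasoning
    identity : ∀ y k → y + k - k ≡ y
    identity = solve-∀ ℚ-ring
    k≤y+k : ℤtoℚ k ≤ y + ℤtoℚ k
    k≤y+k = subst (_≤ y + ℤtoℚ k) (ℚ.+-identityˡ (ℤtoℚ k)) (ℚ.+-monoˡ-≤ (ℤtoℚ k) 0≤y)
    y+k<1+k : y + ℤtoℚ k < ℤtoℚ (ℤ.suc k)
    y+k<1+k = subst (y + ℤtoℚ k <_) (sym (ℤtoℚ-+ (+ 1) k)) (ℚ.+-monoˡ-< (ℤtoℚ k) y<1)
    floor≡k : floor (y + ℤtoℚ k) ≡ k
    floor≡k = floor-unique k k≤y+k y+k<1+k

  frac-+-Integral : ∀ x {y} → Integral y → frac (x + y) ≡ frac x
  frac-+-Integral x (k , refl) = frac-unique (floor x ℤ.+ k) (frac-nonNeg x) (frac<1 x) (begin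
    x + ℤtoℚ k                              ≡⟨ identity x (ℤtoℚ (floor x)) (ℤtoℚ k) ⟩
    frac x + (ℤtoℚ (floor x) + ℤtoℚ k)      ≡⟨ cong (λ t → frac x + t) (ℤtoℚ-+ (floor x) k) ⟨
    frac x + ℤtoℚ (floor x ℤ.+ k)            ∎)
    where
    open ≡-Reasoning
    identity : ∀ x f k → x + k ≡ (x - f) + (f + k)
    identity = solve-∀ ℚ-ring

  frac-Integral : ∀ {x} → Integral x → frac x ≡ 0ℚ
  frac-Integral (k , refl) =
    frac-unique k ℚ.≤-refl (*<* (ℤ.+<+ ℕ.z<s)) (sym (ℚ.+-identityˡ (ℤtoℚ k)))

  frac-pos : ∀ {x} → ¬ Integral x → 0ℚ < frac x
  frac-pos {x} x∉ℤ with ℚ.<-cmp 0ℚ (frac x)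
  ... | tri< 0<frac _ _ = 0<frac
  ... | tri≈ _ 0≡frac _ = contradiction (floor x , x≡floor) x∉ℤ
    where
    x≡floor : x ≡ ℤtoℚ (floor x)
    x≡floor = begin
      x                             ≡⟨ x≡frac+floor x ⟩
      frac x + ℤtoℚ (floor x)      ≡⟨ cong (_+ ℤtoℚ (floor x)) 0≡frac ⟨
      0ℚ + ℤtoℚ (floor x)          ≡⟨ ℚ.+-identityˡ (ℤtoℚ (floor x)) ⟩
      ℤtoℚ (floor x)               ∎
      where open ≡-Reasoning
  ... | tri> _ _ frac<0 = ⊥-elim (ℚ.<-irrefl refl (ℚ.<-≤-trans frac<0 (frac-nonNeg x)))

  frac-neg : ∀ {x} → ¬ Integral x → frac (- x) ≡ 1ℚ - frac x
  frac-neg {x} x∉ℤ = frac-unique (ℤ.- ℤ.suc (floor x)) 0≤1-frac 1-frac<1 (begin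
    - x                                         ≡⟨ identity x f ⟩
    (1ℚ - (x - f)) + - (1ℚ + f)                 ≡⟨ cong (λ t → (1ℚ - frac x) + - t) (ℤtoℚ-+ (+ 1) (floor x)) ⟨
    (1ℚ - frac x) + - ℤtoℚ (ℤ.suc (floor x))   ≡⟨ cong (λ t → (1ℚ - frac x) + t) (ℤtoℚ-neg (ℤ.suc (floor x))) ⟨
    (1ℚ - frac x) + ℤtoℚ (ℤ.- ℤ.suc (floor x)) ∎)
    where
    open ≡-Reasoning
    f = ℤtoℚ (floor x)
    identity : ∀ x f → - x ≡ (1ℚ - (x - f)) + - (1ℚ + f)
    identity = solve-∀ ℚ-ring
    0≤1-frac : 0ℚ ≤ 1ℚ - frac x
    0≤1-frac = subst (_≤ 1ℚ - frac x) (ℚ.+-inverseʳ (frac x)) (ℚ.+-monoˡ-≤ (- frac x) (ℚ.<⇒≤ (frac<1 x)))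
    1-frac<1 : 1ℚ - frac x < 1ℚ
    1-frac<1 = subst (1ℚ - frac x <_) (ℚ.+-identityʳ 1ℚ)
      (ℚ.+-monoʳ-< 1ℚ (ℚ.neg-antimono-< (frac-pos x∉ℤ)))

  frac+frac-neg≡1 : ∀ {x} → ¬ Integral x → frac x + frac (- x) ≡ 1ℚ
  frac+frac-neg≡1 {x} x∉ℤ = trans (cong (λ t → frac x + t) (frac-neg x∉ℤ)) (identity (frac x))
    where
    identity : ∀ f → f + (1ℚ - f) ≡ 1ℚ
    identity = solve-∀ ℚ-ring

  frac+frac-neg≤1 : ∀ x → frac x + frac (- x) ≤ 1ℚ
  frac+frac-neg≤1 x with integral? x
  ... | no x∉ℤ = ℚ.≤-reflexive (frac+frac-neg≡1 x∉ℤ)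
  ... | yes x∈ℤ rewrite frac-Integral x∈ℤ | frac-Integral (Integral-neg x∈ℤ) = *≤* (ℤ.+≤+ ℕ.z≤n)

  frac-neg-complement : ∀ x y → Integral (x + y) → frac (- y) ≡ frac x
  frac-neg-complement x y x+y∈ℤ = begin
    frac (- y)               ≡⟨ cong frac (identity x y) ⟩
    frac (x + - (x + y))     ≡⟨ frac-+-Integral x (Integral-neg x+y∈ℤ) ⟩
    frac x                   ∎
    where
    open ≡-Reasoning
    identity : ∀ x y → - y ≡ x + - (x + y)
    identity = solve-∀ ℚ-ring

  frac≡⇒Integral[-] : ∀ x y → frac x ≡ frac y → Integral (x - y)
  frac≡⇒Integral[-] x y fx≡fy =
    subst Integral (sym x-y≡) (Integral-+ (floor x , refl) (Integral-neg (floor y , refl)))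
    where
    open ≡-Reasoning
    F = ℤtoℚ (floor x)
    G = ℤtoℚ (floor y)
    identity : ∀ f g h → (f + g) - (f + h) ≡ g - h
    identity = solve-∀ ℚ-ring
    x-y≡ : x - y ≡ F - G
    x-y≡ = begin
      x - y                        ≡⟨ cong₂ _-_ (x≡frac+floor x) (x≡frac+floor y) ⟩
      (frac x + F) - (frac y + G)  ≡⟨ cong (λ t → (t + F) - (frac y + G)) fx≡fy ⟩
      (frac y + F) - (frac y + G)  ≡⟨ identity (frac y) F G ⟩
      F - G                        ∎

  ¬antipodal-half-bounds : ∀ x x′ z z′ → ¬ Integral x → Integral (x + x′) → Integral (z + z′) →
    frac (- x) ≤ ½ * frac (- z) → frac (- x′) ≤ ½ * frac (- z′) → ⊥
  ¬antipodal-half-bounds x x′ z z′ x∉ℤ x+x′∈ℤ z+z′∈ℤ bound bound′ =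
    ℚ.<-irrefl refl (ℚ.≤-<-trans 1≤½ (*<* (ℤ.+<+ (ℕ.s<s ℕ.z<s))))
    where
    open ℚ.≤-Reasoning
    1≤½ : 1ℚ ≤ ½
    1≤½ = begin
      1ℚ                                ≡⟨ frac+frac-neg≡1 x∉ℤ ⟨
      frac x + frac (- x)               ≡⟨ cong (_+ frac (- x)) (frac-neg-complement x x′ x+x′∈ℤ) ⟨
      frac (- x′) + frac (- x)          ≤⟨ ℚ.+-mono-≤ bound′ bound ⟩
      ½ * frac (- z′) + ½ * frac (- z)  ≡⟨ cong (λ t → ½ * t + ½ * frac (- z)) (frac-neg-complement z z′ z+z′∈ℤ) ⟩
      ½ * frac z + ½ * frac (- z)       ≡⟨ ℚ.*-distribˡ-+ ½ (frac z) (frac (- z)) ⟨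
      ½ * (frac z + frac (- z))         ≤⟨ ℚ.*-monoˡ-≤-nonNeg ½ (frac+frac-neg≤1 z) ⟩
      ½                                 ∎

  antipodal-bounds⇒frac≡ : ∀ x x′ h h′ → ¬ Integral x → Integral (x + x′) → Integral (h + h′) →
    frac (- x) ≤ frac (- h) → frac (- x′) ≤ frac (- h′) → frac x ≡ frac h
  antipodal-bounds⇒frac≡ x x′ h h′ x∉ℤ x+x′∈ℤ h+h′∈ℤ bound bound′ =
    ℚ.≤-antisym frac[x]≤frac[h] frac[h]≤frac[x]
    where
    open ℚ.≤-Reasoning
    identity : ∀ f g → f ≡ (f + g) - g
    identity = solve-∀ ℚ-ring
    frac[x]≤frac[h] : frac x ≤ frac h
    frac[x]≤frac[h] =
      subst₂ _≤_ (frac-neg-complement x x′ x+x′∈ℤ) (frac-neg-complement h h′ h+h′∈ℤ) bound′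
    frac[h]≤frac[x] : frac h ≤ frac x
    frac[h]≤frac[x] = begin
      frac h                              ≡⟨ identity (frac h) (frac (- h)) ⟩
      (frac h + frac (- h)) - frac (- h)  ≤⟨ ℚ.+-monoˡ-≤ (- frac (- h)) (frac+frac-neg≤1 h) ⟩
      1ℚ - frac (- h)                     ≤⟨ ℚ.+-monoʳ-≤ 1ℚ (ℚ.neg-antimono-≤ bound) ⟩
      1ℚ - frac (- x)                     ≡⟨ cong (_- frac (- x)) (frac+frac-neg≡1 x∉ℤ) ⟨
      (frac x + frac (- x)) - frac (- x)  ≡⟨ identity (frac x) (frac (- x)) ⟨
      frac x                              ∎

  module _ {M c} (m n : ℕ) (M∣m+n : M ∣ m ℕ.+ n) (m⊥M : Coprime m M)
           (Mc∈ℤ : Integral (ℕtoℚ M * c)) (c∉ℤ : ¬ Integral c) where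

    private
      antipodal : ∀ {y} → Integral (ℕtoℚ M * y) → Integral (ℕtoℚ m * y + ℕtoℚ n * y)
      antipodal {y} My∈ℤ =
        subst Integral (trans (cong (_* y) (ℕtoℚ-+ m n)) (ℚ.*-distribʳ-+ y (ℕtoℚ m) (ℕtoℚ n)))
          (Integral-multiple M∣m+n My∈ℤ)

      mc∉ℤ : ¬ Integral (ℕtoℚ m * c)
      mc∉ℤ mc∈ℤ = c∉ℤ (Integral-coprime m⊥M mc∈ℤ Mc∈ℤ)

    ¬antipodal-bounds : ∀ {a} → Integral (ℕtoℚ M * a) →
      frac (- (ℕtoℚ m * c)) ≤ ½ * frac (- (two * (ℕtoℚ m * a))) →
      frac (- (ℕtoℚ n * c)) ≤ ½ * frac (- (two * (ℕtoℚ n * a))) → ⊥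
    ¬antipodal-bounds {a} Ma∈ℤ =
      ¬antipodal-half-bounds (ℕtoℚ m * c) (ℕtoℚ n * c) (two * (ℕtoℚ m * a)) (two * (ℕtoℚ n * a))
        mc∉ℤ (antipodal Mc∈ℤ) 2ma+2na∈ℤ
      where
      2ma+2na∈ℤ : Integral (two * (ℕtoℚ m * a) + two * (ℕtoℚ n * a))
      2ma+2na∈ℤ = subst Integral (ℚ.*-distribˡ-+ two (ℕtoℚ m * a) (ℕtoℚ n * a))
        (Integral-* (+ 2 , refl) (antipodal Ma∈ℤ))

    antipodal-bounds-½⇒Integral[2c] : Integral (ℕtoℚ M * ½) →
      frac (- (ℕtoℚ m * c)) ≤ frac (- (ℕtoℚ m * ½)) →
      frac (- (ℕtoℚ n * c)) ≤ frac (- (ℕtoℚ n * ½)) → Integral (two * c)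
    antipodal-bounds-½⇒Integral[2c] M½∈ℤ m-bound n-bound =
      subst Integral (identity₂ c) (Integral-+ (Integral-* (+ 2 , refl) c-½∈ℤ) (+ 1 , refl))
      where
      identity₁ : ∀ m c → m * c - m * ½ ≡ m * (c - ½)
      identity₁ = solve-∀ ℚ-ring
      identity₂ : ∀ c → two * (c - ½) + 1ℚ ≡ two * c
      identity₂ = solve-∀ ℚ-ring
      frac≡ : frac (ℕtoℚ m * c) ≡ frac (ℕtoℚ m * ½)
      frac≡ = antipodal-bounds⇒frac≡ (ℕtoℚ m * c) (ℕtoℚ n * c) (ℕtoℚ m * ½) (ℕtoℚ n * ½)
        mc∉ℤ (antipodal Mc∈ℤ) (antipodal M½∈ℤ) m-bound n-bound
      c-½∈ℤ : Integral (c - ½)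
      c-½∈ℤ = Integral-coprime m⊥M
        (subst Integral (identity₁ (ℕtoℚ m) c) (frac≡⇒Integral[-] (ℕtoℚ m * c) (ℕtoℚ m * ½) frac≡))
        (subst Integral (identity₁ (ℕtoℚ M) c) (Integral-+ Mc∈ℤ (Integral-neg M½∈ℤ)))

  InB-antipodal-free : ∀ {a c u v} → 0ℚ < a → a < 1ℚ → 0ℚ < c → c < 1ℚ →
    ¬ (IsInt (two * a) × IsInt (two * c)) → InB a c u → InB a c v → ¬ M₁ a c ∣ u ℕ.+ v
  InB-antipodal-free {a} {c} {u} {v} 0<a a<1 0<c c<1 ¬both (_ , u⊥M , u∈B) (_ , _ , v∈B) M∣u+v =
    by-cases (↧ₙ (two * a) ℕ.≟ 1) (u∈B 1) (v∈B 1)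
    where
    M = M₁ a c
    -- BCond a c u 1 is phrased with u ^ 1, which does not reduce to u.
    u¹ = u ℕ.^ 1
    v¹ = v ℕ.^ 1
    M∣u¹+v¹ : M ∣ u¹ ℕ.+ v¹
    M∣u¹+v¹ = subst (M ∣_) (sym (cong₂ ℕ._+_ (ℕ.^-identityʳ u) (ℕ.^-identityʳ v))) M∣u+v
    u¹⊥M : Coprime u¹ M
    u¹⊥M = subst (λ w → Coprime w M) (sym (ℕ.^-identityʳ u)) u⊥M
    Mc∈ℤ : Integral (ℕtoℚ M * c)
    Mc∈ℤ = Integral-multiple (n∣lcm[m,n] (↧ₙ a) (↧ₙ c)) (Integral[↧q*q] c)
    Ma∈ℤ : Integral (ℕtoℚ M * a)
    Ma∈ℤ = Integral-multiple (m∣lcm[m,n] (↧ₙ a) (↧ₙ c)) (Integral[↧q*q] a)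
    c∉ℤ : ¬ Integral c
    c∉ℤ = ¬Integral-between-0-1 0<c c<1
    by-cases : Dec (IsInt (two * a)) → BCond a c u 1 → BCond a c v 1 → ⊥
    by-cases (no 2a∉ℤ) (u-bound , _) (v-bound , _) =
      ¬antipodal-bounds u¹ v¹ M∣u¹+v¹ u¹⊥M Mc∈ℤ c∉ℤ Ma∈ℤ (u-bound 2a∉ℤ) (v-bound 2a∉ℤ)
    by-cases (yes 2a∈ℤ) (_ , u-bound) (_ , v-bound) = ¬both (2a∈ℤ , Integral⇒IsInt 2c∈ℤ)
      where
      M½∈ℤ : Integral (ℕtoℚ M * ½)
      M½∈ℤ = subst (λ t → Integral (ℕtoℚ M * t))
        (Integral[2a]⇒a≡½ 0<a a<1 (IsInt⇒Integral 2a∈ℤ)) Ma∈ℤ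
      2c∈ℤ : Integral (two * c)
      2c∈ℤ = antipodal-bounds-½⇒Integral[2c] u¹ v¹ M∣u¹+v¹ u¹⊥M Mc∈ℤ c∉ℤ M½∈ℤ
        (u-bound 2a∈ℤ) (v-bound 2a∈ℤ)

open FractionalPart using (InB-antipodal-free)

-- Antipodal-free sets of units mod M

open import Data.Nat using (zero; _*_; _≤_; _+_; _∸_; z≤n; s≤s)
open import Data.Nat.Properties
  using (*-identityˡ; ∸-cancelˡ-≡; m∸n+n≡m; m+[n∸m]≡n; ∸-monoʳ-<; <⇒≤; module ≤-Reasoning)
open import Data.Nat.Divisibility using (_∣_; _∣0; ∣-refl; ∣m+n∣m⇒∣n)
open import Data.Nat.Coprimality using (Coprime; coprime?)
open import Data.List using (List; []; _∷_; _++_; map; length; filter; upTo)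
open import Data.List.Properties using (length-++; length-map; length-++-sucʳ)
open import Data.List.Relation.Unary.All as All using (All; []; _∷_)
import Data.List.Relation.Unary.All.Properties as All
open import Data.List.Relation.Unary.Any using (here; there)
open import Data.List.Relation.Unary.AllPairs using ([]; _∷_)
open import Data.List.Relation.Unary.Unique.Propositional using (Unique)
import Data.List.Relation.Unary.Unique.Propositional.Properties as Unique
open import Data.List.Membership.Propositional using (_∈_)
open import Data.List.Relation.Binary.Disjoint.Propositional using (Disjoint)
open import Data.List.Membership.Propositional.Properties
  using (∈-∃++; ∈-++⁻; ∈-++⁺ˡ; ∈-++⁺ʳ; ∈-map⁻; ∈-filter⁺; ∈-upTo⁺)
open import Data.Sum using (inj₁; inj₂)
open import Function using (_∘_)

∈-++-∷⁻ : ∀ {a} {A : Set a} us {vs} {x z : A} → x ≢ z → z ∈ us ++ x ∷ vs → z ∈ us ++ vs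
∈-++-∷⁻ us x≢z z∈ with ∈-++⁻ us z∈
... | inj₁ z∈us         = ∈-++⁺ˡ z∈us
... | inj₂ (here z≡x)   = contradiction (sym z≡x) x≢z
... | inj₂ (there z∈vs) = ∈-++⁺ʳ us z∈vs

Unique⇒length≤ : ∀ {a} {A : Set a} {xs ys : List A} →
  Unique xs → All (_∈ ys) xs → length xs ≤ length ys
Unique⇒length≤ [] [] = z≤n
Unique⇒length≤ {xs = x ∷ xs} (x∉xs ∷ xs!) (x∈ys ∷ xs⊆ys) with ∈-∃++ x∈ys
... | us , vs , refl = subst (suc (length xs) ≤_) (sym (length-++-sucʳ us x vs))
  (s≤s (Unique⇒length≤ xs! (All.zipWith (λ (x≢z , z∈ys) → ∈-++-∷⁻ us x≢z z∈ys) (x∉xs , xs⊆ys))))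

Unique-map-∸ : ∀ {M xs} → All (_≤ M) xs → Unique xs → Unique (map (M ∸_) xs)
Unique-map-∸ [] [] = []
Unique-map-∸ (x≤M ∷ xs≤M) (x∉xs ∷ xs!) =
  All.map⁺ (All.zipWith (λ (y≤M , x≢y) → x≢y ∘ ∸-cancelˡ-≡ x≤M y≤M) (xs≤M , x∉xs))
    ∷ Unique-map-∸ xs≤M xs!

coprime-∸ : ∀ {m n} → n ≤ m → Coprime n m → Coprime (m ∸ n) m
coprime-∸ {m} {n} n≤m n⊥m (d∣m∸n , d∣m) =
  n⊥m (∣m+n∣m⇒∣n (subst (_ ∣_) (sym (m∸n+n≡m n≤m)) d∣m) d∣m∸n , d∣m)

units : ℕ → List ℕ
units M = filter (λ k → coprime? k M) (upTo M)

∈-units : ∀ {M u} → u ℕ.< M → Coprime u M → u ∈ units M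
∈-units {M} u<M u⊥M = ∈-filter⁺ (λ k → coprime? k M) (∈-upTo⁺ u<M) u⊥M

antipodal-free⇒2*length≤φ : ∀ M (S : List ℕ) → Unique S → All (λ u → u ℕ.< M × Coprime u M) S →
  (∀ {u v} → u ∈ S → v ∈ S → ¬ M ∣ u + v) → 2 * length S ≤ φ M
antipodal-free⇒2*length≤φ M S S! S⊆units antipodal-free = begin
  2 * length S                ≡⟨ cong (length S +_) (*-identityˡ (length S)) ⟩
  length S + length S         ≡⟨ cong (length S +_) (length-map (M ∸_) S) ⟨
  length S + length S⁻        ≡⟨ length-++ S ⟨
  length (S ++ S⁻)            ≤⟨ Unique⇒length≤ S++S⁻! S++S⁻⊆units ⟩
  length (units M)            ∎
  where
  open ≤-Reasoning
  S⁻ = map (M ∸_) S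
  S≤M : All (_≤ M) S
  S≤M = All.map (<⇒≤ ∘ proj₁) S⊆units
  u>0 : ∀ {u} → u ∈ S → 0 ℕ.< u
  u>0 {zero}  u∈S = contradiction (M ∣0) (antipodal-free u∈S u∈S)
  u>0 {suc _} _   = s≤s z≤n
  disjoint : Disjoint S S⁻
  disjoint (v∈S , v∈S⁻) with ∈-map⁻ (M ∸_) v∈S⁻
  ... | u , u∈S , refl =
    antipodal-free u∈S v∈S (subst (M ∣_) (sym (m+[n∸m]≡n (All.lookup S≤M u∈S))) ∣-refl)
  S++S⁻! : Unique (S ++ S⁻)
  S++S⁻! = Unique.++⁺ S! (Unique-map-∸ S≤M S!) disjoint
  S++S⁻⊆units : All (_∈ units M) (S ++ S⁻)
  S++S⁻⊆units = All.++⁺ (All.map (uncurry ∈-units) S⊆units)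
    (All.map⁺ (All.tabulate λ {u} u∈S → let u≤M = All.lookup S≤M u∈S in
      ∈-units (∸-monoʳ-< (u>0 u∈S) u≤M) (coprime-∸ u≤M (proj₂ (All.lookup S⊆units u∈S)))))

open import Data.Rational using (ℚ; 0ℚ; 1ℚ; _<_)
import Data.Rational

proposition5p1 : (a c : ℚ) → 0ℚ < a → a < 1ℚ → 0ℚ < c → c < 1ℚ →
    ¬ (IsInt (two Data.Rational.* a) × IsInt (two Data.Rational.* c)) →
    (S : List ℕ) → Unique S → All (InB a c) S →
    2 * length S ≤ φ (M₁ a c)
proposition5p1 a c 0<a a<1 0<c c<1 ¬both S S! S⊆B =
  antipodal-free⇒2*length≤φ (M₁ a c) S S! (All.map (map₂ proj₁) S⊆B)
    (λ u∈S v∈S → InB-antipodal-free 0<a a<1 0<c c<1 ¬both (All.lookup S⊆B u∈S) (All.lookup S⊆B v∈S))
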